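{- Let $P_n$ denote the path on $n$ vertices. For integers $s,t\ge 2$, $$\mathrm{fix}(P_s*P_t)=\begin{cases}1 & \text{if } s,t\ge 4,\\ 2 & \text{if } s=2,\ t\ge 4,\\ 3 & \text{if } s=t=2 \text{ or } (s=2,\ t=3),\\ 5 & \text{if } s=t=3,\\ t+1 & \text{if } s=3,\ t\ge 4.\end{cases}$$
   Context: All graphs are finite and simple. For graphs $G_1,G_2$, the co-normal product $G_1*G_2$ is the graph with vertex set $V(G_1)\times V(G_2)$ in which $(a,b)$ and $(c,d)$ are adjacent if and only if $a$ is adjacent to $c$ in $G_1$ or $b$ is adjacent to $d$ in $G_2$. A set $F\subseteq V(G)$ is a fixing set of $G$ if the only automorphism of $G$ fixing every vertex of $F$ is the identity; $\mathrm{fix}(G)$ is the minimum cardinality of a fixing set. -}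

module Defs where

open import Level using (0ℓ)
open import Data.Nat using (ℕ; suc; _≤_)
open import Data.Fin using (Fin; toℕ)
open import Data.Product using (_×_; _,_; Σ)
open import Data.Sum using (_⊎_)
open import Data.List using (List; length)
open import Data.List.Membership.Propositional using (_∈_)
open import Data.List.Relation.Unary.Unique.Propositional using (Unique)
open import Relation.Binary.PropositionalEquality using (_≡_)
open import Relation.Nullary using (¬_)
open import Function.Bundles using (_⤖_; Bijection; _⇔_)

record Graph : Set₁ where
  field
    V     : Set
    Adj   : V → V → Set
    sym   : ∀ {x y} → Adj x y → Adj y x
    irrefl : ∀ {x} → ¬ Adj x x
open Graph public

PathAdj : (n : ℕ) → Fin n → Fin n → Set
PathAdj n i j = (suc (toℕ i) ≡ toℕ j) ⊎ (suc (toℕ j) ≡ toℕ i)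

P : ℕ → Graph
P n = record
  { V = Fin n
  ; Adj = PathAdj n
  ; sym = λ { (Data.Sum.inj₁ e) → Data.Sum.inj₂ e ; (Data.Sum.inj₂ e) → Data.Sum.inj₁ e }
  ; irrefl = irr
  }
  where
    open import Data.Nat.Properties using (1+n≢n)
    irr : ∀ {x} → ¬ PathAdj n x x
    irr {x} (Data.Sum.inj₁ e) = 1+n≢n e
    irr {x} (Data.Sum.inj₂ e) = 1+n≢n e

_✱_ : Graph → Graph → Graph
G₁ ✱ G₂ = record
  { V = V G₁ × V G₂
  ; Adj = λ { (a , b) (c , d) → Adj G₁ a c ⊎ Adj G₂ b d }
  ; sym = λ { (Data.Sum.inj₁ e) → Data.Sum.inj₁ (sym G₁ e) ; (Data.Sum.inj₂ e) → Data.Sum.inj₂ (sym G₂ e) }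
  ; irrefl = λ { (Data.Sum.inj₁ e) → irrefl G₁ e ; (Data.Sum.inj₂ e) → irrefl G₂ e }
  }

IsAutomorphism : (G : Graph) → (V G ⤖ V G) → Set
IsAutomorphism G σ = ∀ x y → Adj G x y ⇔ Adj G (f x) (f y)
  where f = Bijection.to σ

IsFixingSet : (G : Graph) → List (V G) → Set
IsFixingSet G F = (σ : V G ⤖ V G) → IsAutomorphism G σ →
  (∀ v → v ∈ F → Bijection.to σ v ≡ v) → ∀ v → Bijection.to σ v ≡ v

FixNumber : Graph → ℕ → Set
FixNumber G k =
  Σ (List (V G)) (λ F → Unique F × length F ≡ k × IsFixingSet G F)
  × (∀ F → Unique F → IsFixingSet G F → k ≤ length F)

module Submission where

-- Upper bounds: for each case a set F is shown fixing by propagating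
-- fixedness from F to all vertices with three tools, proved first.
--  * Pinning: an automorphism preserves adjacency to vertices it fixes, so if
--    x is the only vertex (up to already fixed ones) with its adjacency to
--    them, x is fixed. Clamping coordinates at 6 makes this a finite check,
--    done by evaluation, even on grids of unbounded size.
--  * Row propagation: if two consecutive rows are fixed on a window of
--    columns whose neighbourhoods tell columns apart, so is the next row;
--    by transposition the same holds for columns.
--  * Domination (neighbourhood inclusion) is preserved; it locates the images
--    of vertices near the corner when s, t ≥ 4 and F = {(0 , 1)}.
-- Lower bounds: a fixing set must meet every pair of twins (their
-- transposition is an automorphism) and every set of rows that can be
-- flipped (mirrored) as a whole.

open import Defs
open import Data.Nat using (ℕ; _≤_; _+_)
open import Data.Product using (_×_)
open import Relation.Binary.PropositionalEquality using (_≡_)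

open import Data.Nat using (zero; suc; _<_; z≤n; s≤s; pred)
open import Data.Product using (Σ; _,_; proj₁; proj₂; swap)
open import Data.Sum using (_⊎_; inj₁; inj₂; [_,_])
import Data.Sum as Sum
import Data.Bool as Bool
open import Data.Bool using (Bool; T; true; false; _∧_)
open import Data.Bool.Properties using (T-∧)
open import Data.Product.Properties using (≡-dec)
open import Data.Empty using (⊥; ⊥-elim)
open import Data.Unit using (⊤; tt)
open import Data.Nat.Induction using (<-rec)
open import Data.Fin as Fin using (Fin; toℕ; fromℕ<; opposite; _↑ˡ_)
open import Data.Fin.Properties using (toℕ-injective; toℕ<n; toℕ-fromℕ<; opposite-prop; opposite-involutive; toℕ-↑ˡ; pigeonhole)
open import Function.Construct.Symmetry using (⇔-sym)
open import Data.List using (List; []; _∷_; _++_; length; filter; concat; map; upTo; cartesianProduct; allFin; tabulate)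
open import Data.Nat.ListAction using (sum)
open import Data.List.Properties using (filter-all; filter-++; length-++; length-tabulate)
open import Data.List.Relation.Unary.All using (All; []; _∷_; all?)
import Data.List.Relation.Unary.All as All
import Data.List.Relation.Unary.All.Properties as All
open import Data.List.Relation.Unary.AllPairs using (AllPairs; []; _∷_; allPairs?)
open import Data.List.Relation.Unary.Any using (Any; here; there; any?)
import Data.List.Relation.Unary.Any as Any
open import Data.List.Membership.Propositional using (_∈_; find)
open import Data.List.Membership.Propositional.Properties using (∈-filter⁻; ∈-map⁺; ∈-map⁻; ∈-cartesianProduct⁺; ∈-upTo⁺; ∈-allFin; ∈-tabulate⁺)
import Data.List.Membership.DecPropositional as DecMembership
open import Data.List.Relation.Unary.Unique.Propositional using (Unique)
import Data.List.Relation.Unary.Unique.Propositional.Properties as Unique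
open import Function.Bundles using (Bijection; Equivalence; _⤖_; _⇔_; mk⤖; mk⇔)
open import Relation.Binary.Definitions using (DecidableEquality; tri<; tri≈; tri>)
open import Relation.Binary.PropositionalEquality using (refl; trans; cong; cong₂; subst; subst₂; _≢_)
import Relation.Binary.PropositionalEquality as ≡
open import Relation.Nullary using (Dec; yes; no; ¬_)
open import Relation.Nullary.Decidable using (_⊎-dec_; _×-dec_; _→-dec_; does; does-⇔; map′; ¬?)
import Data.Nat.Properties as ℕ
open import Function.Base using (_∘_; case_of_)

pattern 0F = Fin.zero
pattern 1F = Fin.suc Fin.zero
pattern 2F = Fin.suc (Fin.suc Fin.zero)
pattern 3F = Fin.suc (Fin.suc (Fin.suc Fin.zero))

module _ {A : Set} where

  remove : ∀ {x : A} (F : List A) → x ∈ F → List A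
  remove (_ ∷ F) (here _)  = F
  remove (y ∷ F) (there p) = y ∷ remove F p

  length-remove : ∀ {x : A} (F : List A) (p : x ∈ F) → suc (length (remove F p)) ≡ length F
  length-remove (_ ∷ F) (here _)  = refl
  length-remove (_ ∷ F) (there p) = cong suc (length-remove F p)

  ∈-remove : ∀ {x z : A} (F : List A) (p : x ∈ F) → z ∈ F → z ≢ x → z ∈ remove F p
  ∈-remove (_ ∷ F) (here refl) (here refl) z≢x = ⊥-elim (z≢x refl)
  ∈-remove (_ ∷ F) (here refl) (there q)   _   = q
  ∈-remove (_ ∷ F) (there p)   (here e)    _   = here e
  ∈-remove (_ ∷ F) (there p)   (there q)   z≢x = there (∈-remove F p q z≢x)

  unique-⊆-length : ∀ (L F : List A) → Unique L → All (_∈ F) L → length L ≤ length F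
  unique-⊆-length []      F _ _ = z≤n
  unique-⊆-length (x ∷ L) F (x∉L ∷ unique) (x∈F ∷ L⊆F) =
    subst (suc (length L) ≤_) (length-remove F x∈F)
      (s≤s (unique-⊆-length L (remove F x∈F) unique (shrink L⊆F x∉L)))
    where
      shrink : ∀ {K} → All (_∈ F) K → All (x ≢_) K → All (_∈ remove F x∈F) K
      shrink []             []             = []
      shrink (z∈F ∷ K⊆F) (x≢z ∷ distinct) = ∈-remove F x∈F z∈F (λ z≡x → x≢z (≡.sym z≡x)) ∷ shrink K⊆F distinct


module _ (G : Graph) where

  _⊑_ : V G → V G → Set
  x ⊑ y = x ≢ y × (∀ z → Adj G z x → Adj G z y)

  Twins : V G → V G → Set
  Twins x y = x ≢ y × (∀ z → z ≢ x → z ≢ y → Adj G z x ⇔ Adj G z y)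

  module Automorphism (σ : V G ⤖ V G) (aut : IsAutomorphism G σ) where

    f : V G → V G
    f = Bijection.to σ

    f-injective : ∀ {x y} → f x ≡ f y → x ≡ y
    f-injective = Bijection.injective σ

    preimage : ∀ y → Σ (V G) λ x → f x ≡ y
    preimage y = proj₁ (Bijection.surjective σ y) , proj₂ (Bijection.surjective σ y) refl

    preserves : ∀ {x y} → Adj G x y → Adj G (f x) (f y)
    preserves {x} {y} = Equivalence.to (aut x y)

    reflects : ∀ {x y} → Adj G (f x) (f y) → Adj G x y
    reflects {x} {y} = Equivalence.from (aut x y)

    transport : ∀ {x w w′} → f w ≡ w′ → Adj G x w ⇔ Adj G (f x) w′
    transport refl = mk⇔ preserves reflects

    collide : ∀ {x y v} → f x ≡ v → f y ≡ v → x ≢ y → ⊥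
    collide fx≡v fy≡v x≢y = x≢y (f-injective (trans fx≡v (≡.sym fy≡v)))

    onto-fixed : ∀ {x z} → f x ≡ z → f z ≡ z → f x ≡ x
    onto-fixed fx≡z fz≡z = trans fx≡z (≡.sym (f-injective (trans fx≡z (≡.sym fz≡z))))

    ⊑-preserved : ∀ {x y} → x ⊑ y → f x ⊑ f y
    ⊑-preserved {x} {y} (x≢y , N⊆N) = (λ e → x≢y (f-injective e)) , neighbours
      where
        neighbours : ∀ z → Adj G z (f x) → Adj G z (f y)
        neighbours z z~fx with preimage z
        ... | z′ , refl = preserves (N⊆N z′ (reflects z~fx))

    ⊑-reflected : ∀ {x y} → f x ⊑ f y → x ⊑ y
    ⊑-reflected (fx≢fy , N⊆N) = (λ e → fx≢fy (cong f e)) , λ z z~x → reflects (N⊆N (f z) (preserves z~x))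

  involution-rigid : ∀ {F} → IsFixingSet G F →
    (g : V G → V G) → (∀ x → g (g x) ≡ x) → (∀ x y → Adj G x y ⇔ Adj G (g x) (g y)) →
    (∀ v → v ∈ F → g v ≡ v) → ∀ v → g v ≡ v
  involution-rigid fixing g inv = fixing bijection
    where
      bijection : V G ⤖ V G
      bijection = mk⤖ ((λ {x} {y} e → trans (≡.sym (inv x)) (trans (cong g e) (inv y)))
                      , λ y → g y , λ {z} z≡gy → trans (cong g z≡gy) (inv y))

  module WithDecidableVertices (_≟_ : DecidableEquality (V G)) where

    -- The transposition of two twins is an automorphism, so a fixing set
    -- contains at least one vertex of every pair of twins.
    module Exchange {x y} (twins : Twins x y) where

      private
        x≢y = proj₁ twins
        same = proj₂ twins

      exchange : V G → V G
      exchange z with z ≟ x | z ≟ y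
      ... | yes _ | _     = y
      ... | no _  | yes _ = x
      ... | no _  | no _  = z

      exchange-x : exchange x ≡ y
      exchange-x with x ≟ x
      ... | yes _   = refl
      ... | no x≢x = ⊥-elim (x≢x refl)

      exchange-y : exchange y ≡ x
      exchange-y with y ≟ x | y ≟ y
      ... | yes y≡x | _      = ⊥-elim (x≢y (≡.sym y≡x))
      ... | no _    | yes _  = refl
      ... | no _    | no y≢y = ⊥-elim (y≢y refl)

      exchange-other : ∀ {z} → z ≢ x → z ≢ y → exchange z ≡ z
      exchange-other {z} z≢x z≢y with z ≟ x | z ≟ y
      ... | yes z≡x | _       = ⊥-elim (z≢x z≡x)
      ... | no _    | yes z≡y = ⊥-elim (z≢y z≡y)
      ... | no _    | no _    = refl

      data Position (z : V G) : Set where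
        is-x  : z ≡ x → Position z
        is-y  : z ≡ y → Position z
        other : z ≢ x → z ≢ y → Position z

      position : ∀ z → Position z
      position z with z ≟ x | z ≟ y
      ... | yes z≡x | _       = is-x z≡x
      ... | no _    | yes z≡y = is-y z≡y
      ... | no z≢x  | no z≢y  = other z≢x z≢y

      involutive : ∀ z → exchange (exchange z) ≡ z
      involutive z with position z
      ... | is-x refl = trans (cong exchange exchange-x) exchange-y
      ... | is-y refl = trans (cong exchange exchange-y) exchange-x
      ... | other z≢x z≢y = trans (cong exchange (exchange-other z≢x z≢y)) (exchange-other z≢x z≢y)

      preserves : ∀ p q → Adj G p q → Adj G (exchange p) (exchange q)
      preserves p q p~q with position p | position q
      ... | is-x refl | is-x refl = ⊥-elim (irrefl G p~q)
      ... | is-y refl | is-y refl = ⊥-elim (irrefl G p~q)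
      ... | is-x refl | is-y refl rewrite exchange-x | exchange-y = Graph.sym G p~q
      ... | is-y refl | is-x refl rewrite exchange-x | exchange-y = Graph.sym G p~q
      ... | is-x refl | other q≢x q≢y rewrite exchange-x | exchange-other q≢x q≢y =
        Graph.sym G (Equivalence.to (same q q≢x q≢y) (Graph.sym G p~q))
      ... | is-y refl | other q≢x q≢y rewrite exchange-y | exchange-other q≢x q≢y =
        Graph.sym G (Equivalence.from (same q q≢x q≢y) (Graph.sym G p~q))
      ... | other p≢x p≢y | is-x refl rewrite exchange-x | exchange-other p≢x p≢y =
        Equivalence.to (same p p≢x p≢y) p~q
      ... | other p≢x p≢y | is-y refl rewrite exchange-y | exchange-other p≢x p≢y =
        Equivalence.from (same p p≢x p≢y) p~q
      ... | other p≢x p≢y | other q≢x q≢y rewrite exchange-other p≢x p≢y | exchange-other q≢x q≢y = p~q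

      automorphic : ∀ p q → Adj G p q ⇔ Adj G (exchange p) (exchange q)
      automorphic p q = mk⇔ (preserves p q)
        (λ a → subst₂ (Adj G) (involutive p) (involutive q) (preserves (exchange p) (exchange q) a))

    open DecMembership _≟_ using (_∈?_)

    twins-meet : ∀ {F x y} → IsFixingSet G F → Twins x y → x ∈ F ⊎ y ∈ F
    twins-meet {F} {x} {y} fixing twins with x ∈? F | y ∈? F
    ... | yes x∈F | _       = inj₁ x∈F
    ... | no _    | yes y∈F = inj₂ y∈F
    ... | no x∉F  | no y∉F  = ⊥-elim (proj₁ twins (≡.sym (trans (≡.sym exchange-x) (rigid x))))
      where
        open Exchange twins
        rigid : ∀ v → exchange v ≡ v
        rigid = involution-rigid fixing exchange involutive automorphic λ v v∈F →
          exchange-other (λ v≡x → x∉F (subst (_∈ F) v≡x v∈F)) (λ v≡y → y∉F (subst (_∈ F) v≡y v∈F))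

    -- Counting members of a fixing set F: all but at most one vertex of a
    -- pairwise-twin group lies in F, so disjoint twin groups g force at least
    -- Σ (|g| - 1) members.
    module Counting {F} (fixing : IsFixingSet G F) where

      inF : List (V G) → List (V G)
      inF = filter (_∈? F)

      group-bound : ∀ g → AllPairs Twins g → length g ≤ suc (length (inF g))
      group-bound []      []                    = z≤n
      group-bound (x ∷ g) (x-twins ∷ pairwise) with x ∈? F
      ... | yes x∈F = s≤s (group-bound g pairwise)
      ... | no x∉F  = s≤s (ℕ.≤-reflexive (cong length (≡.sym (filter-all (_∈? F) (others x-twins)))))
        where
          others : ∀ {h} → All (Twins x) h → All (_∈ F) h
          others []                   = []
          others (twin ∷ rest) with twins-meet fixing twin
          ... | inj₁ x∈F = ⊥-elim (x∉F x∈F)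
          ... | inj₂ z∈F = z∈F ∷ others rest

      groups-bound : ∀ gs → All (AllPairs Twins) gs → sum (map (pred ∘ length) gs) ≤ length (inF (concat gs))
      groups-bound []       []                = z≤n
      groups-bound (g ∷ gs) (pairwise ∷ rest) =
        subst (λ n → pred (length g) + sum (map (pred ∘ length) gs) ≤ n)
          (≡.sym (trans (cong length (filter-++ (_∈? F) g (concat gs))) (length-++ (inF g))))
          (ℕ.+-mono-≤ (ℕ.pred-mono-≤ (group-bound g pairwise)) (groups-bound gs rest))

      fixing-set-bound : ∀ gs → All (AllPairs Twins) gs → Unique (concat gs) → sum (map (pred ∘ length) gs) ≤ length F
      fixing-set-bound gs pairwise unique =
        ℕ.≤-trans (groups-bound gs pairwise) (unique-⊆-length _ F (Unique.filter⁺ (_∈? F) unique) members)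
        where
          members : All (_∈ F) (inF (concat gs))
          members = All.tabulate (λ m → proj₂ (∈-filter⁻ (_∈? F) {xs = concat gs} m))

Step : ℕ → ℕ → Set
Step m n = suc m ≡ n ⊎ suc n ≡ m

step? : ∀ m n → Dec (Step m n)
step? m n = (suc m ℕ.≟ n) ⊎-dec (suc n ℕ.≟ m)

step-irrefl : ∀ {n} → ¬ Step n n
step-irrefl (inj₁ e) = ℕ.1+n≢n e
step-irrefl (inj₂ e) = ℕ.1+n≢n e

step-sym : ∀ {m n} → Step m n → Step n m
step-sym (inj₁ e) = inj₂ e
step-sym (inj₂ e) = inj₁ e

step-gap : ∀ n → ¬ Step n (suc (suc n))
step-gap n (inj₁ e) = ℕ.1+n≢n (≡.sym (ℕ.suc-injective e))
step-gap n (inj₂ e) = ℕ.m≢1+n+m n (≡.sym e)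

step-three : ∀ n → ¬ Step (suc (suc (suc n))) n
step-three n (inj₁ e) = ℕ.m≢1+n+m n (≡.sym e)
step-three n (inj₂ e) = ℕ.m≢1+n+m n (ℕ.suc-injective e)

no-triangle : ∀ {a b c} → Step a b → Step a c → ¬ Step b c
no-triangle (inj₁ refl) (inj₁ refl) = step-irrefl
no-triangle (inj₂ refl) (inj₂ refl) = step-irrefl
no-triangle (inj₁ refl) (inj₂ refl) = step-gap _ ∘ step-sym
no-triangle (inj₂ refl) (inj₁ refl) = step-gap _

below : ∀ {n} (P : ℕ → Set) → (∀ (e : Fin n) → P (toℕ e)) → ∀ e → e < n → P e
below P all e e<n = subst P (toℕ-fromℕ< e<n) (all (fromℕ< e<n))

-- In a path, indices two apart have equal neighbourhoods only in P₃ (the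
-- two ends of P₃); so for n ≢ 3 the neighbourhood determines the index.
two-apart : ∀ n c → suc (suc c) < n → (∀ e → e < n → Step c e ⇔ Step (suc (suc c)) e) → n ≡ 3
two-apart n (suc c) c+3<n same =
  ⊥-elim (step-three c (Equivalence.to (same c (ℕ.≤-<-trans (ℕ.m≤n+m c 3) c+3<n)) (inj₂ refl)))
two-apart n zero 2<n same with 3 ℕ.<? n
... | yes 3<n = ⊥-elim (step-three 0 (step-sym (Equivalence.from (same 3 3<n) (inj₁ refl))))
... | no 3≮n  = ℕ.≤-antisym (ℕ.≮⇒≥ 3≮n) 2<n

equal-neighbourhoods : ∀ n a c → a < c → c < n → (∀ e → e < n → Step a e ⇔ Step c e) → n ≡ 3
equal-neighbourhoods n a c a<c c<n same with Equivalence.to (same (suc a) (ℕ.≤-<-trans a<c c<n)) (inj₁ refl)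
... | inj₁ c+1≡a+1 = ⊥-elim (ℕ.<-irrefl (≡.sym (ℕ.suc-injective c+1≡a+1)) a<c)
... | inj₂ refl    = two-apart n a c<n same

neighbourhood-determines : ∀ n a c → n ≢ 3 → a < n → c < n → (∀ e → e < n → Step a e ⇔ Step c e) → a ≡ c
neighbourhood-determines n a c n≢3 a<n c<n same with ℕ.<-cmp a c
... | tri≈ _ a≡c _ = a≡c
... | tri< a<c _ _ = ⊥-elim (n≢3 (equal-neighbourhoods n a c a<c c<n same))
... | tri> _ _ c<a = ⊥-elim (n≢3 (equal-neighbourhoods n c a c<a a<n λ e e<n → ⇔-sym (same e e<n)))

path-determined : ∀ {n} → n ≢ 3 → (a c : Fin n) → (∀ e → PathAdj n a e ⇔ PathAdj n c e) → a ≡ c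
path-determined {n} n≢3 a c same = toℕ-injective
  (neighbourhood-determines n (toℕ a) (toℕ c) n≢3 (toℕ<n a) (toℕ<n c)
    (below (λ e → Step (toℕ a) e ⇔ Step (toℕ c) e) same))

window-determined : ∀ b d → b ≤ 3 → (∀ e → e ≤ 3 → Step d e ⇔ Step b e) → d ≡ b
window-determined 0 d _ same with Equivalence.from (same 1 (s≤s z≤n)) (inj₁ refl)
... | inj₁ refl = refl
... | inj₂ refl = ⊥-elim (step-three 0 (step-sym (Equivalence.to (same 3 (s≤s (s≤s (s≤s z≤n)))) (inj₁ refl))))
window-determined 1 d _ same with Equivalence.from (same 0 z≤n) (inj₂ refl)
... | inj₂ refl = refl
window-determined 2 d _ same with Equivalence.from (same 1 (s≤s z≤n)) (inj₂ refl)
... | inj₁ refl = ⊥-elim (step-three 0 (step-sym (Equivalence.from (same 3 (s≤s (s≤s (s≤s z≤n)))) (inj₁ refl))))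
... | inj₂ refl = refl
window-determined 3 d _ same with Equivalence.from (same 2 (s≤s (s≤s z≤n))) (inj₂ refl)
... | inj₁ refl = ⊥-elim (step-three 0 (Equivalence.to (same 0 z≤n) (inj₂ refl)))
... | inj₂ refl = refl
window-determined (suc (suc (suc (suc _)))) _ (s≤s (s≤s (s≤s ()))) _

data Domination (n c c′ : ℕ) : Set where
  self      : c′ ≡ c → Domination n c c′
  first-end : c ≡ 0 → c′ ≡ 2 → Domination n c c′
  last-end  : suc c ≡ n → suc (suc c′) ≡ c → Domination n c c′

path-domination : ∀ n c c′ → 2 ≤ n → c < n → (∀ k → k < n → Step k c → Step k c′) → Domination n c c′
path-domination n zero c′ 2≤n _ dominated with dominated 1 2≤n (inj₂ refl)
... | inj₁ refl = first-end refl refl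
... | inj₂ refl = self refl
path-domination n (suc m) c′ _ m+1<n dominated with dominated m (ℕ.<-trans (ℕ.n<1+n m) m+1<n) (inj₁ refl)
... | inj₁ refl = self refl
... | inj₂ refl with suc (suc m) ℕ.<? n
...   | yes m+2<n = ⊥-elim (step-three c′ (dominated (suc (suc m)) m+2<n (inj₂ refl)))
...   | no m+2≮n  = last-end (ℕ.≤-antisym m+1<n (ℕ.≮⇒≥ m+2≮n)) refl

interior-undominated : ∀ {n c c′} → c ≢ 0 → suc c ≢ n → Domination n c c′ → c′ ≡ c
interior-undominated _   _   (self c′≡c)          = c′≡c
interior-undominated c≢0 _   (first-end c≡0 _)    = ⊥-elim (c≢0 c≡0)
interior-undominated _   c≢n (last-end c+1≡n _)   = ⊥-elim (c≢n c+1≡n)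

proper-dominator-unique : ∀ {n c c₁ c₂} → Domination n c c₁ → Domination n c c₂ → c₁ ≢ c → c₂ ≢ c → c₁ ≡ c₂
proper-dominator-unique (self e) _ c₁≢c _ = ⊥-elim (c₁≢c e)
proper-dominator-unique _ (self e) _ c₂≢c = ⊥-elim (c₂≢c e)
proper-dominator-unique (first-end _ e₁) (first-end _ e₂) _ _ = trans e₁ (≡.sym e₂)
proper-dominator-unique (last-end _ e₁) (last-end _ e₂) _ _ = ℕ.suc-injective (ℕ.suc-injective (trans e₁ (≡.sym e₂)))
proper-dominator-unique (first-end refl _) (last-end _ ()) _ _
proper-dominator-unique (last-end _ ()) (first-end refl _) _ _

index-below : ∀ {n} (i : Fin n) j → j < toℕ i → Fin n
index-below i j j<i = fromℕ< (ℕ.<-trans j<i (toℕ<n i))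

toℕ-index-below : ∀ {n} (i : Fin n) j (j<i : j < toℕ i) → toℕ (index-below i j j<i) ≡ j
toℕ-index-below i j j<i = toℕ-fromℕ< (ℕ.<-trans j<i (toℕ<n i))

-- An injective adjacency-preserving self-map of a path fixing the first
-- vertex is the identity: g (b + 1) is adjacent to g b = b, and it is not
-- b - 1 = g (b - 1) by injectivity.
path-end-rigid : ∀ {n} (g : Fin n → Fin n) → (∀ {b c} → g b ≡ g c → b ≡ c) →
  (∀ {b c} → PathAdj n b c → PathAdj n (g b) (g c)) → (∀ b → toℕ b ≡ 0 → g b ≡ b) → ∀ b → g b ≡ b
path-end-rigid {n} g injective adjacent first b = <-rec Goal step (toℕ b) b refl
  where
    Goal : ℕ → Set
    Goal k = ∀ b → toℕ b ≡ k → g b ≡ b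
    step : ∀ k → (∀ {m} → m < k → Goal m) → Goal k
    step zero     _  b b≡0   = first b b≡0
    step (suc k) IH b b≡k+1 = settle (subst (PathAdj n (g b)) fixed-b′ (adjacent (inj₂ b′+1≡b)))
      where
        k<b : k < toℕ b
        k<b = subst (k <_) (≡.sym b≡k+1) ℕ.≤-refl
        b′ = index-below b k k<b
        b′+1≡b : suc (toℕ b′) ≡ toℕ b
        b′+1≡b = trans (cong suc (toℕ-index-below b k k<b)) (≡.sym b≡k+1)
        fixed-b′ : g b′ ≡ b′
        fixed-b′ = IH (ℕ.n<1+n k) b′ (toℕ-index-below b k k<b)
        settle : PathAdj n (g b) b′ → g b ≡ b
        settle (inj₂ b′+1≡gb) = toℕ-injective (trans (≡.sym b′+1≡gb) b′+1≡b)
        settle (inj₁ gb+1≡b′) = ⊥-elim (ℕ.m≢1+n+m k (≡.sym (trans (cong suc (≡.sym gb≡b)) gb+1≡k)))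
          where
            gb+1≡k : suc (toℕ (g b)) ≡ k
            gb+1≡k = trans gb+1≡b′ (toℕ-index-below b k k<b)
            -- g b lies below b, so is fixed by g; injectivity then makes it b.
            gb≡b : toℕ (g b) ≡ suc k
            gb≡b = trans (cong toℕ (injective (IH (ℕ.≤-trans (ℕ.≤-reflexive gb+1≡k) (ℕ.n≤1+n k)) (g b) refl))) b≡k+1

Vertex : ℕ → ℕ → Set
Vertex s t = Fin s × Fin t

Point : Set
Point = ℕ × ℕ

point : ∀ {s t} → Vertex s t → Point
point (i , j) = toℕ i , toℕ j

point-injective : ∀ {s t} {x y : Vertex s t} → point x ≡ point y → x ≡ y
point-injective e = cong₂ _,_ (toℕ-injective (cong proj₁ e)) (toℕ-injective (cong proj₂ e))

_⋈_ : Point → Point → Set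
(a , b) ⋈ (c , d) = Step a c ⊎ Step b d

_⋈?_ : ∀ p q → Dec (p ⋈ q)
(a , b) ⋈? (c , d) = step? a c ⊎-dec step? b d

grid-domination : ∀ {s t} {x y : Vertex s t} → 2 ≤ s → 2 ≤ t → _⊑_ (P s ✱ P t) x y →
  Domination s (toℕ (proj₁ x)) (toℕ (proj₁ y)) × Domination t (toℕ (proj₂ x)) (toℕ (proj₂ y))
grid-domination {s} {t} {x₁ , x₂} {y₁ , y₂} 2≤s 2≤t (_ , N⊆N) =
  path-domination s _ _ 2≤s (toℕ<n x₁) rows , path-domination t _ _ 2≤t (toℕ<n x₂) cols
  where
    rows : ∀ k → k < s → Step k (toℕ x₁) → Step k (toℕ y₁)
    rows = below (λ k → Step k (toℕ x₁) → Step k (toℕ y₁)) λ e e~x →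
      [ (λ e~y → e~y) , (λ y~y → ⊥-elim (step-irrefl y~y)) ] (N⊆N (e , y₂) (inj₁ e~x))
    cols : ∀ k → k < t → Step k (toℕ x₂) → Step k (toℕ y₂)
    cols = below (λ k → Step k (toℕ x₂) → Step k (toℕ y₂)) λ e e~x →
      [ (λ y~y → ⊥-elim (step-irrefl y~y)) , (λ e~y → e~y) ] (N⊆N (y₁ , e) (inj₂ e~x))

End : ℕ → ℕ → Set
End n c = c ≡ 0 ⊎ suc c ≡ n

end? : ∀ n c → End n c ⊎ (c ≢ 0 × suc c ≢ n)
end? n c with c ℕ.≟ 0 | suc c ℕ.≟ n
... | yes c≡0 | _        = inj₁ (inj₁ c≡0)
... | no _    | yes last = inj₁ (inj₂ last)
... | no c≢0  | no ¬last = inj₂ (c≢0 , ¬last)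

-- A vertex with two distinct proper dominators is a corner: were one
-- coordinate interior, both dominators would share it with x and then agree
-- in the other coordinate as well.
two-dominators-corner : ∀ {s t} {x y₁ y₂ : Vertex s t} → 2 ≤ s → 2 ≤ t →
  _⊑_ (P s ✱ P t) x y₁ → _⊑_ (P s ✱ P t) x y₂ → y₁ ≢ y₂ →
  End s (toℕ (proj₁ x)) × End t (toℕ (proj₂ x))
two-dominators-corner {s} {t} {x} {y₁} {y₂} 2≤s 2≤t x⊑y₁ x⊑y₂ y₁≢y₂ = row-end , col-end
  where
    d₁ = grid-domination 2≤s 2≤t x⊑y₁
    d₂ = grid-domination 2≤s 2≤t x⊑y₂
    differs : ∀ {y} → _⊑_ (P s ✱ P t) x y → point y ≢ point x
    differs (x≢y , _) e = x≢y (point-injective (≡.sym e))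
    row-end : End s (toℕ (proj₁ x))
    row-end with end? s (toℕ (proj₁ x))
    ... | inj₁ end = end
    ... | inj₂ (≢0 , ≢last) = ⊥-elim (y₁≢y₂ (point-injective (cong₂ _,_ (trans r₁ (≡.sym r₂))
            (proper-dominator-unique (proj₂ d₁) (proj₂ d₂)
              (λ c → differs x⊑y₁ (cong₂ _,_ r₁ c)) (λ c → differs x⊑y₂ (cong₂ _,_ r₂ c))))))
      where
        r₁ = interior-undominated ≢0 ≢last (proj₁ d₁)
        r₂ = interior-undominated ≢0 ≢last (proj₁ d₂)
    col-end : End t (toℕ (proj₂ x))
    col-end with end? t (toℕ (proj₂ x))
    ... | inj₁ end = end
    ... | inj₂ (≢0 , ≢last) = ⊥-elim (y₁≢y₂ (point-injective (cong₂ _,_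
            (proper-dominator-unique (proj₁ d₁) (proj₁ d₂)
              (λ r → differs x⊑y₁ (cong₂ _,_ r c₁)) (λ r → differs x⊑y₂ (cong₂ _,_ r c₂)))
            (trans c₁ (≡.sym c₂)))))
      where
        c₁ = interior-undominated ≢0 ≢last (proj₂ d₁)
        c₂ = interior-undominated ≢0 ≢last (proj₂ d₂)

-- A set of columns along which fixedness propagates from row to row: it
-- contains two adjacent columns, and the neighbours of a column inside the
-- set determine that column among all columns.
record Window (t : ℕ) : Set₁ where
  field
    In         : Fin t → Set
    e₀ e₁      : Fin t
    e₀∈        : In e₀
    e₁∈        : In e₁
    adjacent   : PathAdj t e₀ e₁
    determines : ∀ {b d} → In b → (∀ e → In e → PathAdj t d e ⇔ PathAdj t b e) → d ≡ b

whole-path : ∀ {t} → 2 ≤ t → t ≢ 3 → Window t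
Window.In         (whole-path _ _) _ = ⊤
Window.e₀         (whole-path (s≤s (s≤s z≤n)) _) = 0F
Window.e₁         (whole-path (s≤s (s≤s z≤n)) _) = 1F
Window.e₀∈        (whole-path _ _) = tt
Window.e₁∈        (whole-path _ _) = tt
Window.adjacent   (whole-path (s≤s (s≤s z≤n)) _) = inj₁ refl
Window.determines (whole-path _ t≢3) {b} {d} _ same = path-determined t≢3 d b λ e → same e tt

first-four : ∀ {t} → 3 < t → Window t
Window.In         (first-four _) e = toℕ e ≤ 3
Window.e₀         (first-four (s≤s (s≤s _))) = 0F
Window.e₁         (first-four (s≤s (s≤s _))) = 1F
Window.e₀∈        (first-four (s≤s (s≤s _))) = z≤n
Window.e₁∈        (first-four (s≤s (s≤s _))) = s≤s z≤n
Window.adjacent   (first-four (s≤s (s≤s _))) = inj₁ refl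
Window.determines (first-four 3<t) {b} {d} b≤3 same = toℕ-injective (window-determined (toℕ b) (toℕ d) b≤3 λ e e≤3 →
  below (λ e → e ≤ 3 → Step (toℕ d) e ⇔ Step (toℕ b) e) same e (ℕ.≤-<-trans e≤3 3<t) e≤3)

-- Clamping at 6. Adjacency to an index below 5 cannot tell an index ≥ 6
-- from 6, so for comparisons with vertices near the corner every vertex of an
-- arbitrarily large grid is represented inside the box [0,7) × [0,7).
clamp : ℕ → ℕ
clamp (suc (suc (suc (suc (suc (suc _)))))) = 6
clamp n = n

clamp-step : ∀ a {c} → c < 5 → Step a c ⇔ Step (clamp a) c
clamp-step 0 _ = mk⇔ (λ h → h) (λ h → h)
clamp-step 1 _ = mk⇔ (λ h → h) (λ h → h)
clamp-step 2 _ = mk⇔ (λ h → h) (λ h → h)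
clamp-step 3 _ = mk⇔ (λ h → h) (λ h → h)
clamp-step 4 _ = mk⇔ (λ h → h) (λ h → h)
clamp-step 5 _ = mk⇔ (λ h → h) (λ h → h)
clamp-step (suc (suc (suc (suc (suc (suc k)))))) c<5 = mk⇔ (⊥-elim ∘ far k c<5) (⊥-elim ∘ far 0 c<5)
  where
    far : ∀ k {c} → c < 5 → ¬ Step (suc (suc (suc (suc (suc (suc k)))))) c
    far k c<5 (inj₁ e) = ℕ.<⇒≱ c<5 (subst (5 ≤_) e (s≤s (s≤s (s≤s (s≤s (s≤s z≤n))))))
    far k c<5 (inj₂ e) = ℕ.<⇒≱ c<5 (subst (5 ≤_) (≡.sym (ℕ.suc-injective e)) (s≤s (s≤s (s≤s (s≤s (s≤s z≤n))))))

clamp-small : ∀ a {c} → c < 5 → clamp a ≡ c → a ≡ c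
clamp-small 0 _ e = e
clamp-small 1 _ e = e
clamp-small 2 _ e = e
clamp-small 3 _ e = e
clamp-small 4 _ e = e
clamp-small 5 _ e = e
clamp-small (suc (suc (suc (suc (suc (suc _)))))) c<5 refl = ⊥-elim (ℕ.<⇒≱ c<5 (s≤s (s≤s (s≤s (s≤s (s≤s z≤n))))))

clamp-≤ : ∀ n → clamp n ≤ n
clamp-≤ 0 = z≤n
clamp-≤ 1 = ℕ.≤-refl
clamp-≤ 2 = ℕ.≤-refl
clamp-≤ 3 = ℕ.≤-refl
clamp-≤ 4 = ℕ.≤-refl
clamp-≤ 5 = ℕ.≤-refl
clamp-≤ (suc (suc (suc (suc (suc (suc n)))))) = s≤s (s≤s (s≤s (s≤s (s≤s (s≤s z≤n)))))

clamp-<7 : ∀ n → clamp n < 7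
clamp-<7 n@0 = ℕ.≤-<-trans (clamp-≤ n) (s≤s z≤n)
clamp-<7 n@1 = ℕ.≤-<-trans (clamp-≤ n) (s≤s (s≤s z≤n))
clamp-<7 n@2 = ℕ.≤-<-trans (clamp-≤ n) (s≤s (s≤s (s≤s z≤n)))
clamp-<7 n@3 = ℕ.≤-<-trans (clamp-≤ n) (s≤s (s≤s (s≤s (s≤s z≤n))))
clamp-<7 n@4 = ℕ.≤-<-trans (clamp-≤ n) (s≤s (s≤s (s≤s (s≤s (s≤s z≤n)))))
clamp-<7 n@5 = ℕ.≤-<-trans (clamp-≤ n) (s≤s (s≤s (s≤s (s≤s (s≤s (s≤s z≤n))))))
clamp-<7 (suc (suc (suc (suc (suc (suc _)))))) = ℕ.≤-refl

Covers : ℕ → ℕ → Set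
Covers n r = ∀ (i : Fin n) → clamp (toℕ i) < r

covers-exactly : ∀ n → Covers n n
covers-exactly n i = ℕ.≤-<-trans (clamp-≤ (toℕ i)) (toℕ<n i)

covers-by-7 : ∀ n → Covers n 7
covers-by-7 n i = clamp-<7 (toℕ i)

NearCorner : Point → Set
NearCorner (a , b) = a < 5 × b < 5

clamp-⋈ : ∀ a b {w} → NearCorner w → ((a , b) ⋈ w) ⇔ ((clamp a , clamp b) ⋈ w)
clamp-⋈ a b {c , d} (c<5 , d<5) =
  mk⇔ (Sum.map (Equivalence.to (clamp-step a c<5)) (Equivalence.to (clamp-step b d<5)))
      (Sum.map (Equivalence.from (clamp-step a c<5)) (Equivalence.from (clamp-step b d<5)))

-- A list of pairs (w , w′) describes a map on some points by w ↦ w′. An automorphism extending the map sends x to such a y.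
Agrees : Point → Point → List (Point × Point) → Set
Agrees y x W = All (λ (w , w′) → does (y ⋈? w′) ≡ does (x ⋈? w)) W

agrees? : ∀ y x W → Dec (Agrees y x W)
agrees? y x = all? λ (w , w′) → does (y ⋈? w′) Bool.≟ does (x ⋈? w)

box : ℕ → ℕ → List Point
box rs ts = cartesianProduct (upTo rs) (upTo ts)

open DecMembership (≡-dec ℕ._≟_ ℕ._≟_) using () renaming (_∈?_ to _∈ᵖ?_)

Pinned : Point → List (Point × Point) → List Point → ℕ → ℕ → Set
Pinned x W A rs ts = All (NearCorner ∘ proj₂) W × All NearCorner A × All (λ y → Agrees y x W → y ∈ A) (box rs ts)

near-corner? : ∀ p → Dec (NearCorner p)
near-corner? (a , b) = (a ℕ.<? 5) ×-dec (b ℕ.<? 5)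

pinned? : ∀ x W A rs ts → Dec (Pinned x W A rs ts)
pinned? x W A rs ts =
  all? (near-corner? ∘ proj₂) W ×-dec all? near-corner? A ×-dec all? (λ y → agrees? y x W →-dec y ∈ᵖ? A) (box rs ts)

evidence : ∀ {A : Set} (a? : Dec A) → T (does a?) → A
evidence (yes a) _ = a

agrees-clamped : ∀ a b x W → All (NearCorner ∘ proj₂) W → Agrees (a , b) x W → Agrees (clamp a , clamp b) x W
agrees-clamped a b x []              []             []             = []
agrees-clamped a b x ((w , w′) ∷ W) (near ∷ nears) (agree ∷ rest) =
  trans (≡.sym (does-⇔ (clamp-⋈ a b near) ((a , b) ⋈? w′) ((clamp a , clamp b) ⋈? w′))) agree
  ∷ agrees-clamped a b x W nears rest

points : ∀ {s t} → List (Vertex s t × Vertex s t) → List (Point × Point)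
points = map λ (w , w′) → point w , point w′

diagonal : ∀ {s t} → List (Vertex s t) → List (Vertex s t × Vertex s t)
diagonal = map λ k → k , k

propagates : ∀ {s t} → List (Vertex s t) → List (Vertex s t) → ℕ → ℕ → Bool
propagates K []       rs ts = true
propagates K (x ∷ xs) rs ts =
  does (pinned? (point x) (points (diagonal K)) (map point (x ∷ K)) rs ts) ∧ propagates (x ∷ K) xs rs ts

module GridAutomorphism {s t} (σ : Vertex s t ⤖ Vertex s t) (aut : IsAutomorphism (P s ✱ P t) σ) where
  open Automorphism (P s ✱ P t) σ aut public

  Fixed : Vertex s t → Set
  Fixed z = f z ≡ z

  Maps : List (Vertex s t × Vertex s t) → Set
  Maps W = All (λ (w , w′) → f w ≡ w′) W

  image-agrees : ∀ x W → Maps W → Agrees (point (f x)) (point x) (points W)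
  image-agrees x []              []              = []
  image-agrees x ((w , w′) ∷ W) (fw≡w′ ∷ maps) =
    does-⇔ (⇔-sym (transport fw≡w′)) (point (f x) ⋈? point w′) (point x ⋈? point w) ∷ image-agrees x W maps

  -- The pinning principle: if σ is known on W and x is pinned to A by W,
  -- then σ x ∈ A. The box search covers σ x through its clamped point.
  image-pinned : ∀ {rs ts} → Covers s rs → Covers t ts → ∀ x W A → Maps W →
    T (does (pinned? (point x) (points W) (map point A) rs ts)) → f x ∈ A
  image-pinned {rs} {ts} covers-s covers-t x W A maps check = subst (_∈ A) (≡.sym fx≡v) v∈A
    where
      found = evidence (pinned? (point x) (points W) (map point A) rs ts) check
      a = toℕ (proj₁ (f x))
      b = toℕ (proj₂ (f x))
      clamped∈A : (clamp a , clamp b) ∈ map point A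
      clamped∈A = All.lookup (proj₂ (proj₂ found))
        (∈-cartesianProduct⁺ (∈-upTo⁺ (covers-s (proj₁ (f x)))) (∈-upTo⁺ (covers-t (proj₂ (f x)))))
        (agrees-clamped a b (point x) (points W) (proj₁ found) (image-agrees x W maps))
      v = proj₁ (∈-map⁻ point clamped∈A)
      v∈A = proj₁ (proj₂ (∈-map⁻ point clamped∈A))
      clamped≡v = proj₂ (proj₂ (∈-map⁻ point clamped∈A))
      v-near = All.lookup (proj₁ (proj₂ found)) (∈-map⁺ point v∈A)
      fx≡v : f x ≡ v
      fx≡v = point-injective (cong₂ _,_ (clamp-small a (proj₁ v-near) (cong proj₁ clamped≡v))
                                        (clamp-small b (proj₂ v-near) (cong proj₂ clamped≡v)))

  pinned-fixed : ∀ {rs ts} → Covers s rs → Covers t ts → ∀ x K → All Fixed K →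
    T (does (pinned? (point x) (points (diagonal K)) (map point (x ∷ K)) rs ts)) → Fixed x
  pinned-fixed covers-s covers-t x K fixed check =
    settle (image-pinned covers-s covers-t x (diagonal K) (x ∷ K) (All.map⁺ fixed) check)
    where
      settle : f x ∈ x ∷ K → Fixed x
      settle (here fx≡x)  = fx≡x
      settle (there fx∈K) = onto-fixed refl (All.lookup fixed fx∈K)

  propagate : ∀ {rs ts} → Covers s rs → Covers t ts → ∀ K xs → All Fixed K → T (propagates K xs rs ts) → All Fixed xs
  propagate covers-s covers-t K []       _     _     = []
  propagate covers-s covers-t K (x ∷ xs) fixed check =
    fixed-x ∷ propagate covers-s covers-t (x ∷ K) xs (fixed-x ∷ fixed) (proj₂ (Equivalence.to T-∧ check))
    where
      fixed-x = pinned-fixed covers-s covers-t x K fixed (proj₁ (Equivalence.to T-∧ check))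

  -- The image of (r , b) is adjacent to
  -- the fixed row k + 1 on two adjacent columns, so it lies in row k or k + 2;
  -- comparing adjacency with the fixed row k pins its column to b.
  row-step : (W : Window t) (r : Fin s) (k : ℕ) → toℕ r ≡ suc (suc k) →
    (∀ z → toℕ (proj₁ z) < toℕ r → Window.In W (proj₂ z) → Fixed z) →
    ∀ b → Window.In W b → Fixed (r , b)
  row-step W r k r≡k+2 above b b∈ = settle image-row
    where
      open Window W
      k+1<r : suc k < toℕ r
      k+1<r = subst (suc k <_) (≡.sym r≡k+2) ℕ.≤-refl
      k<r : k < toℕ r
      k<r = ℕ.<-trans (ℕ.n<1+n k) k+1<r
      r₀ = index-below r k k<r
      r₁ = index-below r (suc k) k+1<r
      z = f (r , b)
      c = toℕ (proj₁ z)
      d = proj₂ z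
      fixed : ∀ {r′} → toℕ r′ < toℕ r → ∀ e → In e → Fixed (r′ , e)
      fixed r′<r e e∈ = above (_ , e) r′<r e∈
      fixed₀ = fixed (subst (_< toℕ r) (≡.sym (toℕ-index-below r k k<r)) k<r)
      fixed₁ = fixed (subst (_< toℕ r) (≡.sym (toℕ-index-below r (suc k) k+1<r)) k+1<r)
      rows-k-k+2 : ¬ Step (toℕ r) (toℕ r₀)
      rows-k-k+2 h = step-gap k (step-sym (subst₂ Step r≡k+2 (toℕ-index-below r k k<r) h))
      r₁+1≡r : suc (toℕ r₁) ≡ toℕ r
      r₁+1≡r = trans (cong suc (toℕ-index-below r (suc k) k+1<r)) (≡.sym r≡k+2)
      image-row : Step c (suc k)
      image-row with Equivalence.to (transport (fixed₁ e₀ e₀∈)) (inj₁ (inj₂ r₁+1≡r))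
                   | Equivalence.to (transport (fixed₁ e₁ e₁∈)) (inj₁ (inj₂ r₁+1≡r))
      ... | inj₁ c~r₁ | _         = subst (Step c) (toℕ-index-below r (suc k) k+1<r) c~r₁
      ... | inj₂ _    | inj₁ c~r₁ = subst (Step c) (toℕ-index-below r (suc k) k+1<r) c~r₁
      ... | inj₂ d~e₀ | inj₂ d~e₁ = ⊥-elim (no-triangle d~e₀ d~e₁ adjacent)
      image-not-row₀ : ¬ Step c (toℕ r₀)
      image-not-row₀ h = no-triangle (step-sym image-row) (inj₂ refl) (subst (Step c) (toℕ-index-below r k k<r) h)
      same-column : d ≡ b
      same-column = determines b∈ λ e e∈ → mk⇔
        (λ d~e → [ (λ r~r₀ → ⊥-elim (rows-k-k+2 r~r₀)) , (λ b~e → b~e) ]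
                   (Equivalence.from (transport (fixed₀ e e∈)) (inj₂ d~e)))
        (λ b~e → [ (λ c~r₀ → ⊥-elim (image-not-row₀ c~r₀)) , (λ d~e → d~e) ]
                   (Equivalence.to (transport (fixed₀ e e∈)) (inj₂ b~e)))
      settle : Step c (suc k) → Fixed (r , b)
      settle (inj₁ c+1≡k+1) = onto-fixed refl
        (above z (subst (_< toℕ r) (≡.sym (ℕ.suc-injective c+1≡k+1)) k<r) (subst In (≡.sym same-column) b∈))
      settle (inj₂ k+2≡c) = point-injective (cong₂ _,_ (trans (≡.sym k+2≡c) (≡.sym r≡k+2)) (cong toℕ same-column))

  row-induction : (W : Window t) → (∀ z → toℕ (proj₁ z) < 2 → Window.In W (proj₂ z) → Fixed z) →
    ∀ z → Window.In W (proj₂ z) → Fixed z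
  row-induction W first-rows z = <-rec Goal step (toℕ (proj₁ z)) z refl
    where
      Goal : ℕ → Set
      Goal n = ∀ z → toℕ (proj₁ z) ≡ n → Window.In W (proj₂ z) → Fixed z
      step : ∀ n → (∀ {m} → m < n → Goal m) → Goal n
      step zero          _  z r≡0 = first-rows z (subst (_< 2) (≡.sym r≡0) (s≤s z≤n))
      step (suc zero)    _  z r≡1 = first-rows z (subst (_< 2) (≡.sym r≡1) (s≤s (s≤s z≤n)))
      step (suc (suc k)) IH (r , b) r≡k+2 =
        row-step W r k r≡k+2 (λ z′ z′<r → IH (subst (toℕ (proj₁ z′) <_) r≡k+2 z′<r) z′ refl) b

-- Exchanging the two factors turns an automorphism of P_s ✱ P_t into one of
-- P_t ✱ P_s; this lets row propagation run along columns as well.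
transposed : ∀ {s t} → Vertex s t ⤖ Vertex s t → Vertex t s ⤖ Vertex t s
transposed σ = mk⤖
  ( (λ e → cong swap (Bijection.injective σ (cong swap e)))
  , λ y → swap (proj₁ (Bijection.surjective σ (swap y)))
        , λ z≡ → cong swap (proj₂ (Bijection.surjective σ (swap y)) (cong swap z≡)) )

transposed-automorphism : ∀ {s t} (σ : Vertex s t ⤖ Vertex s t) → IsAutomorphism (P s ✱ P t) σ →
  IsAutomorphism (P t ✱ P s) (transposed σ)
transposed-automorphism σ aut x y =
  mk⇔ (Sum.swap ∘ Equivalence.to (aut (swap x) (swap y)) ∘ Sum.swap)
      (Sum.swap ∘ Equivalence.from (aut (swap x) (swap y)) ∘ Sum.swap)

column-induction : ∀ {s t} (σ : Vertex s t ⤖ Vertex s t) → IsAutomorphism (P s ✱ P t) σ → 2 ≤ s → s ≢ 3 →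
  (∀ z → toℕ (proj₂ z) < 2 → Bijection.to σ z ≡ z) → ∀ z → Bijection.to σ z ≡ z
column-induction σ aut 2≤s s≢3 first-columns z = cong swap
  (GridAutomorphism.row-induction (transposed σ) (transposed-automorphism σ aut) (whole-path 2≤s s≢3)
    (λ z′ z′<2 _ → cong swap (first-columns (swap z′) z′<2)) (swap z) tt)


vertices : ∀ s t → List (Vertex s t)
vertices s t = cartesianProduct (allFin s) (allFin t)

_≟ᵛ_ : ∀ {s t} → DecidableEquality (Vertex s t)
_≟ᵛ_ = ≡-dec Fin._≟_ Fin._≟_

does-≡⇒⇔ : ∀ {A B : Set} (a? : Dec A) (b? : Dec B) → does a? ≡ does b? → A ⇔ B
does-≡⇒⇔ (yes a) (yes b) _ = mk⇔ (λ _ → b) (λ _ → a)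
does-≡⇒⇔ (no ¬a) (no ¬b) _ = mk⇔ (⊥-elim ∘ ¬a) (⊥-elim ∘ ¬b)

TwinsOnList : ∀ {s t} → Vertex s t → Vertex s t → Set
TwinsOnList {s} {t} x y =
  x ≢ y × All (λ z → z ≡ x ⊎ z ≡ y ⊎ does (point z ⋈? point x) ≡ does (point z ⋈? point y)) (vertices s t)

twins? : ∀ {s t} (x y : Vertex s t) → Dec (Twins (P s ✱ P t) x y)
twins? {s} {t} x y = map′ sound complete
  ((¬? (x ≟ᵛ y)) ×-dec all? (λ z → (z ≟ᵛ x) ⊎-dec (z ≟ᵛ y) ⊎-dec (does (point z ⋈? point x) Bool.≟ does (point z ⋈? point y)))
                            (vertices s t))
  where
    sound : TwinsOnList x y → Twins (P s ✱ P t) x y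
    sound (x≢y , checks) = x≢y , λ z z≢x z≢y →
      case All.lookup checks (∈-cartesianProduct⁺ (∈-allFin (proj₁ z)) (∈-allFin (proj₂ z))) of λ where
        (inj₁ z≡x)          → ⊥-elim (z≢x z≡x)
        (inj₂ (inj₁ z≡y))   → ⊥-elim (z≢y z≡y)
        (inj₂ (inj₂ agree)) → does-≡⇒⇔ (point z ⋈? point x) (point z ⋈? point y) agree
    complete : Twins (P s ✱ P t) x y → TwinsOnList x y
    complete (x≢y , same) = x≢y , All.tabulate λ {z} _ → case (z ≟ᵛ x , z ≟ᵛ y) of λ where
      (yes z≡x , _)      → inj₁ z≡x
      (no _ , yes z≡y)   → inj₂ (inj₁ z≡y)
      (no z≢x , no z≢y)  → inj₂ (inj₂ (does-⇔ (same z z≢x z≢y) (point z ⋈? point x) (point z ⋈? point y)))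

module _ {s t : ℕ} where
  open DecMembership (_≟ᵛ_ {s} {t}) using (_∈?_)
  open import Data.List.Relation.Unary.Unique.DecPropositional (_≟ᵛ_ {s} {t}) using (unique?)

  everywhere : ∀ {Q : Vertex s t → Set} (L : List (Vertex s t)) → All Q L →
    T (does (all? (_∈? L) (vertices s t))) → ∀ v → Q v
  everywhere L all-L check v =
    All.lookup all-L (All.lookup (evidence (all? (_∈? L) (vertices s t)) check) (∈-cartesianProduct⁺ (∈-allFin _) (∈-allFin _)))

  propagation-fixing : ∀ F xs → T (propagates F xs s t) → T (does (all? (_∈? (xs ++ F)) (vertices s t))) →
    IsFixingSet (P s ✱ P t) F
  propagation-fixing F xs propagation covering σ aut on-F =
    everywhere (xs ++ F) (All.++⁺ (propagate (covers-exactly s) (covers-exactly t) F xs fixed-F propagation) fixed-F) covering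
    where
      open GridAutomorphism σ aut
      fixed-F : All Fixed F
      fixed-F = All.tabulate (on-F _)

  member-property : ∀ {Q : Vertex s t → Set} (L : List (Vertex s t)) → All Q L → ∀ v → T (does (v ∈? L)) → Q v
  member-property L all-L v check = All.lookup all-L (evidence (v ∈? L) check)

  distinct : ∀ L → T (does (unique? L)) → Unique L
  distinct L = evidence (unique? L)

  twin-groups-bound : ∀ {F} → IsFixingSet (P s ✱ P t) F → ∀ gs →
    T (does (all? (allPairs? twins?) gs)) → T (does (unique? (concat gs))) → sum (map (pred ∘ length) gs) ≤ length F
  twin-groups-bound fixing gs pairwise unique = WithDecidableVertices.Counting.fixing-set-bound (P s ✱ P t) _≟ᵛ_ fixing gs
    (evidence (all? (allPairs? twins?) gs) pairwise) (evidence (unique? (concat gs)) unique)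

mirror-step : ∀ {n} (b d : Fin n) → suc (toℕ b) ≡ toℕ d → suc (toℕ (opposite d)) ≡ toℕ (opposite b)
mirror-step {n} b d b+1≡d rewrite opposite-prop b | opposite-prop d | ≡.sym b+1≡d =
  ≡.sym (ℕ.+-∸-assoc 1 (subst (λ k → suc k ≤ n) (≡.sym b+1≡d) (toℕ<n d)))

mirror-adjacent : ∀ {n} (b d : Fin n) → PathAdj n b d → PathAdj n (opposite b) (opposite d)
mirror-adjacent b d (inj₁ e) = inj₂ (mirror-step b d e)
mirror-adjacent b d (inj₂ e) = inj₁ (mirror-step d b e)

mirror-if : ∀ {n} → Bool → Fin n → Fin n
mirror-if true  = opposite
mirror-if false = λ b → b

flip : ∀ {s t} → (Fin s → Bool) → Vertex s t → Vertex s t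
flip R (a , b) = a , mirror-if (R a) b

flip-involutive : ∀ {s t} (R : Fin s → Bool) (x : Vertex s t) → flip R (flip R x) ≡ x
flip-involutive R (a , b) with R a
... | true  = cong (a ,_) (opposite-involutive b)
... | false = refl

-- When every row of R is adjacent to every row outside R, adjacency across
-- the two parts ignores columns, and within each part the columns are mirrored
-- uniformly; so the flip is an automorphism.
flip-automorphic : ∀ {s t} (R : Fin s → Bool) → (∀ a c → R a ≢ R c → PathAdj s a c) →
  ∀ (x y : Vertex s t) → Adj (P s ✱ P t) x y ⇔ Adj (P s ✱ P t) (flip R x) (flip R y)
flip-automorphic R across (a , b) (c , d) with R a | R c | across a c
... | true  | true  | _ = mk⇔ (Sum.map (λ a~c → a~c) (mirror-adjacent b d))
                              (Sum.map (λ a~c → a~c) (λ m → subst₂ (PathAdj _) (opposite-involutive b) (opposite-involutive d)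
                                                                 (mirror-adjacent _ _ m)))
... | false | false | _ = mk⇔ (λ h → h) (λ h → h)
... | true  | false | a~c = mk⇔ (λ _ → inj₁ (a~c λ ())) (λ _ → inj₁ (a~c λ ()))
... | false | true  | a~c = mk⇔ (λ _ → inj₁ (a~c λ ())) (λ _ → inj₁ (a~c λ ()))

-- A fixing set meets every flippable set of rows: otherwise the flip fixes
-- it, yet moves the first vertex of each flipped row (t ≥ 2).
fixing-meets-flip : ∀ {s t F} → IsFixingSet (P s ✱ P t) F → 2 ≤ t → (R : Fin s → Bool) →
  (∀ a c → R a ≢ R c → PathAdj s a c) → ∀ a → R a ≡ true → Any (λ v → R (proj₁ v) ≡ true) F
fixing-meets-flip {s} {t@(suc (suc _))} {F} fixing (s≤s (s≤s z≤n)) R across a Ra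
  with any? (λ v → R (proj₁ v) Bool.≟ true) F
... | yes found = found
... | no none   = ⊥-elim (moved (involution-rigid (P s ✱ P t) fixing (flip R) (flip-involutive R) (flip-automorphic R across)
                          (λ v v∈F → unflipped v (λ Rv → none (Any.map (λ v≡ → subst (λ u → R (proj₁ u) ≡ true) v≡ Rv) v∈F)))
                          (a , 0F)))
  where
    unflipped : ∀ v → R (proj₁ v) ≢ true → flip R v ≡ v
    unflipped (c , d) ¬Rc with R c
    ... | true  = ⊥-elim (¬Rc refl)
    ... | false = refl
    mirror-moves : ∀ p → p ≡ true → mirror-if {t} p 0F ≢ 0F
    mirror-moves true refl ()
    moved : flip R (a , 0F) ≢ (a , 0F)
    moved e = mirror-moves (R a) Ra (cong proj₂ e)

F-2×2 : List (Vertex 2 2)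
F-2×2 = (0F , 0F) ∷ (0F , 1F) ∷ (1F , 0F) ∷ []

-- P₂ ✱ P₂ is K₄: three vertices fix the fourth, and all four are pairwise twins.
fix-2×2 : FixNumber (P 2 ✱ P 2) 3
fix-2×2 = (F-2×2 , distinct F-2×2 _ , refl , propagation-fixing F-2×2 ((1F , 1F) ∷ []) _ _) ,
  λ F _ fixing → twin-groups-bound fixing (((1F , 1F) ∷ F-2×2) ∷ []) _ _

F-2×3 : List (Vertex 2 3)
F-2×3 = (0F , 0F) ∷ (0F , 1F) ∷ (1F , 0F) ∷ []

-- In P₂ ✱ P₃ the remaining vertices propagate from F; the two ends of each
-- row are twins, as are the two middle vertices.
fix-2×3 : FixNumber (P 2 ✱ P 3) 3
fix-2×3 = (F-2×3 , distinct F-2×3 _ , refl , propagation-fixing F-2×3 ((0F , 2F) ∷ (1F , 1F) ∷ (1F , 2F) ∷ []) _ _) ,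
  λ F _ fixing → twin-groups-bound fixing
    (((0F , 0F) ∷ (0F , 2F) ∷ []) ∷ ((1F , 0F) ∷ (1F , 2F) ∷ []) ∷ ((0F , 1F) ∷ (1F , 1F) ∷ []) ∷ []) _ _

F-3×3 : List (Vertex 3 3)
F-3×3 = (0F , 0F) ∷ (0F , 1F) ∷ (0F , 2F) ∷ (1F , 0F) ∷ (2F , 0F) ∷ []

-- In P₃ ✱ P₃ the remaining vertices propagate from F; the four corners are
-- pairwise twins, and so are the two ends of the middle row and of the middle
-- column.
fix-3×3 : FixNumber (P 3 ✱ P 3) 5
fix-3×3 = (F-3×3 , distinct F-3×3 _ , refl ,
           propagation-fixing F-3×3 ((1F , 1F) ∷ (1F , 2F) ∷ (2F , 1F) ∷ (2F , 2F) ∷ []) _ _) ,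
  λ F _ fixing → twin-groups-bound fixing
    (((0F , 0F) ∷ (0F , 2F) ∷ (2F , 0F) ∷ (2F , 2F) ∷ []) ∷ ((0F , 1F) ∷ (2F , 1F) ∷ []) ∷ ((1F , 0F) ∷ (1F , 2F) ∷ []) ∷ []) _ _

module ThreeRows (t′ : ℕ) where

  private
    t = suc (suc (suc (suc t′)))

  F-3×t : List (Vertex 3 t)
  F-3×t = (1F , 0F) ∷ tabulate (λ b → 0F , b)

  -- Fixing the first row and (1 , 0): the middle row is mapped to itself
  -- (its vertices are the ones adjacent to the whole first row) and there
  -- acts as a path automorphism fixing an end; the last row then follows by
  -- row propagation over all columns.
  fixing : IsFixingSet (P 3 ✱ P t) F-3×t
  fixing σ aut on-F = every
    where
      open GridAutomorphism σ aut
      row₀ : ∀ b → Fixed (0F , b)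
      row₀ b = on-F _ (there (∈-tabulate⁺ {f = λ b → 0F , b} b))
      -- The image of (1 , b) is adjacent to the fixed vertex of row 0 in its
      -- own column, hence lies in row 1.
      stays-middle : ∀ b → proj₁ (f (1F , b)) ≡ 1F
      stays-middle b with Equivalence.to (transport (row₀ (proj₂ (f (1F , b))))) (inj₁ (inj₂ refl))
      ... | inj₁ (inj₂ 1≡c) = toℕ-injective (≡.sym 1≡c)
      ... | inj₂ d~d        = ⊥-elim (step-irrefl d~d)
      along : Fin t → Fin t
      along b = proj₂ (f (1F , b))
      along-vertex : ∀ b → f (1F , b) ≡ (1F , along b)
      along-vertex b = cong (_, along b) (stays-middle b)
      along-adjacent : ∀ {b c} → PathAdj t b c → PathAdj t (along b) (along c)
      along-adjacent {b} {c} b~c with subst₂ (Adj (P 3 ✱ P t)) (along-vertex b) (along-vertex c) (preserves (inj₂ b~c))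
      ... | inj₁ 1~1 = ⊥-elim (step-irrefl 1~1)
      ... | inj₂ b~c′ = b~c′
      along-injective : ∀ {b c} → along b ≡ along c → b ≡ c
      along-injective {b} {c} e = cong proj₂ (f-injective (trans (along-vertex b) (trans (cong (1F ,_) e) (≡.sym (along-vertex c)))))
      row₁ : ∀ b → Fixed (1F , b)
      row₁ b = trans (along-vertex b) (cong (1F ,_)
        (path-end-rigid along along-injective along-adjacent (λ { 0F _ → cong proj₂ (on-F _ (here refl)) }) b))
      row₂ : ∀ b → Fixed (2F , b)
      row₂ b = row-step (whole-path (s≤s (s≤s z≤n)) (λ ())) 2F 0 refl above b tt
        where
          above : ∀ z → toℕ (proj₁ z) < 2 → ⊤ → Fixed z
          above (0F , d) _ _ = row₀ d
          above (1F , d) _ _ = row₁ d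
          above (2F , _) (s≤s (s≤s ())) _
      every : ∀ v → Fixed v
      every (0F , b) = row₀ b
      every (1F , b) = row₁ b
      every (2F , b) = row₂ b

  is-middle : Fin 3 → Bool
  is-middle 0F = false
  is-middle 1F = true
  is-middle 2F = false

  -- The middle row of P₃ is adjacent to both other rows, so it can be flipped.
  middle-adjacent : ∀ a c → is-middle a ≢ is-middle c → PathAdj 3 a c
  middle-adjacent 0F 1F _  = inj₁ refl
  middle-adjacent 1F 0F _  = inj₂ refl
  middle-adjacent 1F 2F _  = inj₁ refl
  middle-adjacent 2F 1F _  = inj₂ refl
  middle-adjacent 0F 0F ne = ⊥-elim (ne refl)
  middle-adjacent 0F 2F ne = ⊥-elim (ne refl)
  middle-adjacent 1F 1F ne = ⊥-elim (ne refl)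
  middle-adjacent 2F 0F ne = ⊥-elim (ne refl)
  middle-adjacent 2F 2F ne = ⊥-elim (ne refl)

  ends-alike : ∀ (c : Fin 3) → PathAdj 3 c 0F ⇔ PathAdj 3 c 2F
  ends-alike 0F = mk⇔ (⊥-elim ∘ step-irrefl) (⊥-elim ∘ step-gap 0)
  ends-alike 1F = mk⇔ (λ _ → inj₁ refl) (λ _ → inj₂ refl)
  ends-alike 2F = mk⇔ (⊥-elim ∘ step-gap 0 ∘ step-sym) (⊥-elim ∘ step-irrefl)

  column-twins : ∀ b → Twins (P 3 ✱ P t) (0F , b) (2F , b)
  column-twins b = (λ ()) , λ (c , d) _ _ →
    mk⇔ (Sum.map (Equivalence.to (ends-alike c)) (λ d~b → d~b)) (Sum.map (Equivalence.from (ends-alike c)) (λ d~b → d~b))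

  -- A fixing set needs a middle-row vertex (else flip the middle row) and one
  -- end of every column (twins): t + 1 distinct members.
  lower-bound : ∀ F → IsFixingSet (P 3 ✱ P t) F → t + 1 ≤ length F
  lower-bound F fixing =
    subst (_≤ length F) (trans (cong suc (length-tabulate (proj₁ ∘ chosen))) (ℕ.+-comm 1 t))
      (unique-⊆-length (y ∷ tabulate (proj₁ ∘ chosen)) F
        (All.tabulate⁺ {f = proj₁ ∘ chosen} (λ b y≡ → middle-not-end b (trans (≡.sym y-middle) (cong (is-middle ∘ proj₁) y≡)))
         ∷ Unique.tabulate⁺ {f = proj₁ ∘ chosen} (λ {i} {j} e → trans (≡.sym (column i)) (trans (cong proj₂ e) (column j))))
        (y∈F ∷ All.tabulate⁺ {f = proj₁ ∘ chosen} (λ b → proj₁ (proj₂ (chosen b)))))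
    where
      middle = find (fixing-meets-flip fixing (s≤s (s≤s z≤n)) is-middle middle-adjacent 1F refl)
      y = proj₁ middle
      y∈F = proj₁ (proj₂ middle)
      y-middle = proj₂ (proj₂ middle)
      chosen : ∀ b → Σ (Vertex 3 t) λ v → v ∈ F × proj₂ v ≡ b × is-middle (proj₁ v) ≡ false
      chosen b with WithDecidableVertices.twins-meet (P 3 ✱ P t) _≟ᵛ_ fixing (column-twins b)
      ... | inj₁ in-F = (0F , b) , in-F , refl , refl
      ... | inj₂ in-F = (2F , b) , in-F , refl , refl
      column : ∀ b → proj₂ (proj₁ (chosen b)) ≡ b
      column b = proj₁ (proj₂ (proj₂ (chosen b)))
      middle-not-end : ∀ b → true ≢ is-middle (proj₁ (proj₁ (chosen b)))
      middle-not-end b e = case trans e (proj₂ (proj₂ (proj₂ (chosen b)))) of λ ()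

  fix-3×t : FixNumber (P 3 ✱ P t) (t + 1)
  fix-3×t = (F-3×t , unique-F , length-F , fixing) , λ F _ → lower-bound F
    where
      unique-F : Unique F-3×t
      unique-F = All.tabulate⁺ {f = λ b → 0F , b} (λ _ ()) ∷ Unique.tabulate⁺ {f = λ b → 0F , b} (cong proj₂)
      length-F : length F-3×t ≡ t + 1
      length-F = trans (cong suc (length-tabulate (λ b → 0F , b))) (ℕ.+-comm 1 t)

module TwoRows (t′ : ℕ) where

  private
    t = suc (suc (suc (suc t′)))

  F-2×t : List (Vertex 2 t)
  F-2×t = (0F , 0F) ∷ (1F , 0F) ∷ []

  -- Fixing column 0: the common neighbours of (0,0) and (1,0) form column 1,
  -- whose two vertices σ either fixes or exchanges. An exchange is impossible:
  -- the image of (0,3) would have to avoid (1,1) and (0,0) yet be adjacent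
  -- to (1,0), and no vertex does that.
  fixing : IsFixingSet (P 2 ✱ P t) F-2×t
  fixing σ aut on-F = column-induction σ aut (s≤s (s≤s z≤n)) (λ ()) first-columns
    where
      open GridAutomorphism σ aut
      fixed-F : All Fixed F-2×t
      fixed-F = All.tabulate (on-F _)
      column₀₁ : List (Vertex 2 t)
      column₀₁ = (0F , 1F) ∷ (1F , 1F) ∷ F-2×t
      in-columns₀₁ : ∀ x → T (does (pinned? (point x) (points (diagonal F-2×t)) (map point column₀₁) 2 7)) → f x ∈ column₀₁
      in-columns₀₁ x = image-pinned (covers-exactly 2) (covers-by-7 t) x (diagonal F-2×t) column₀₁ (All.map⁺ fixed-F)
      no-exchange : f (0F , 1F) ≡ (1F , 1F) → f (1F , 1F) ≡ (0F , 1F) → ⊥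
      no-exchange e₀₁ e₁₁ = nowhere (image-pinned (covers-exactly 2) (covers-by-7 t) (0F , 3F)
        (((0F , 0F) , (0F , 0F)) ∷ ((1F , 0F) , (1F , 0F)) ∷ ((0F , 1F) , (1F , 1F)) ∷ ((1F , 1F) , (0F , 1F)) ∷ []) []
        (All.lookup fixed-F (here refl) ∷ All.lookup fixed-F (there (here refl)) ∷ e₀₁ ∷ e₁₁ ∷ []) _)
        where
          nowhere : f (0F , 3F) ∈ [] → ⊥
          nowhere ()
      settle : f (0F , 1F) ∈ column₀₁ → f (1F , 1F) ∈ column₀₁ → Fixed (0F , 1F) × Fixed (1F , 1F)
      settle (here e₀₁)                       (there (here e₁₁)) = e₀₁ , e₁₁
      settle (there (here e₀₁))               (here e₁₁)         = ⊥-elim (no-exchange e₀₁ e₁₁)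
      settle (here e₀₁)                       (here e₁₁)         = ⊥-elim (collide e₀₁ e₁₁ λ ())
      settle (there (here e₀₁))               (there (here e₁₁)) = ⊥-elim (collide e₀₁ e₁₁ λ ())
      settle (there (there (here e)))         _                  = ⊥-elim (collide e (All.lookup fixed-F (here refl)) λ ())
      settle (there (there (there (here e)))) _                  = ⊥-elim (collide e (All.lookup fixed-F (there (here refl))) λ ())
      settle _ (there (there (here e)))         = ⊥-elim (collide e (All.lookup fixed-F (here refl)) λ ())
      settle _ (there (there (there (here e)))) = ⊥-elim (collide e (All.lookup fixed-F (there (here refl))) λ ())
      column₁ : Fixed (0F , 1F) × Fixed (1F , 1F)
      column₁ = settle (in-columns₀₁ (0F , 1F) _) (in-columns₀₁ (1F , 1F) _)
      first-columns : ∀ z → toℕ (proj₂ z) < 2 → Fixed z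
      first-columns (0F , 0F) _ = All.lookup fixed-F (here refl)
      first-columns (1F , 0F) _ = All.lookup fixed-F (there (here refl))
      first-columns (0F , 1F) _ = proj₁ column₁
      first-columns (1F , 1F) _ = proj₂ column₁
      first-columns (_ , Fin.suc (Fin.suc _)) (s≤s (s≤s ()))

  distinct-adjacent : ∀ (a c : Fin 2) → a ≢ c → PathAdj 2 a c
  distinct-adjacent 0F 1F _   = inj₁ refl
  distinct-adjacent 1F 0F _   = inj₂ refl
  distinct-adjacent 0F 0F a≢c = ⊥-elim (a≢c refl)
  distinct-adjacent 1F 1F a≢c = ⊥-elim (a≢c refl)

  -- Either row of P₂ can be flipped, the two rows being adjacent.
  row-is : Fin 2 → Fin 2 → Bool
  row-is r a = does (a Fin.≟ r)

  flippable : ∀ r a c → row-is r a ≢ row-is r c → PathAdj 2 a c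
  flippable r a c ne = distinct-adjacent a c (λ a≡c → ne (cong (row-is r) a≡c))

  -- One vertex is not enough: flipping the other row keeps it fixed.
  lower-bound : ∀ F → IsFixingSet (P 2 ✱ P t) F → 2 ≤ length F
  lower-bound []              fixing with fixing-meets-flip fixing (s≤s (s≤s z≤n)) (row-is 0F) (flippable 0F) 0F refl
  ... | ()
  lower-bound ((0F , _) ∷ []) fixing with fixing-meets-flip fixing (s≤s (s≤s z≤n)) (row-is 1F) (flippable 1F) 1F refl
  ... | here ()
  lower-bound ((1F , _) ∷ []) fixing with fixing-meets-flip fixing (s≤s (s≤s z≤n)) (row-is 0F) (flippable 0F) 0F refl
  ... | here ()
  lower-bound (_ ∷ _ ∷ _)     _ = s≤s (s≤s z≤n)

  fix-2×t : FixNumber (P 2 ✱ P t) 2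
  fix-2×t = (F-2×t , ((λ ()) ∷ []) ∷ [] ∷ [] , refl , fixing) , λ F _ → lower-bound F

module FourOrMore (s′ t′ : ℕ) where

  private
    s = suc (suc (suc (suc s′)))
    t = suc (suc (suc (suc t′)))
    2≤s : 2 ≤ s
    2≤s = s≤s (s≤s z≤n)
    2≤t : 2 ≤ t
    2≤t = s≤s (s≤s z≤n)
    _⊑ᵍ_ : Vertex s t → Vertex s t → Set
    _⊑ᵍ_ = _⊑_ (P s ✱ P t)

  ⊑-01-21 : (0F , 1F) ⊑ᵍ (2F , 1F)
  ⊑-01-21 = (λ ()) , λ _ → λ { (inj₁ (inj₁ ())) ; (inj₁ (inj₂ e)) → inj₁ (inj₁ (cong suc (≡.sym e))) ; (inj₂ q) → inj₂ q }
  ⊑-00-02 : (0F , 0F) ⊑ᵍ (0F , 2F)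
  ⊑-00-02 = (λ ()) , λ _ → λ { (inj₁ p) → inj₁ p ; (inj₂ (inj₁ ())) ; (inj₂ (inj₂ e)) → inj₂ (inj₁ (cong suc (≡.sym e))) }
  ⊑-00-20 : (0F , 0F) ⊑ᵍ (2F , 0F)
  ⊑-00-20 = (λ ()) , λ _ → λ { (inj₂ p) → inj₂ p ; (inj₁ (inj₁ ())) ; (inj₁ (inj₂ e)) → inj₁ (inj₁ (cong suc (≡.sym e))) }
  ⊑-00-22 : (0F , 0F) ⊑ᵍ (2F , 2F)
  ⊑-00-22 = (λ ()) , λ _ → λ { (inj₁ (inj₁ ())) ; (inj₁ (inj₂ e)) → inj₁ (inj₁ (cong suc (≡.sym e)))
                              ; (inj₂ (inj₁ ())) ; (inj₂ (inj₂ e)) → inj₂ (inj₁ (cong suc (≡.sym e))) }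
  ⊑-02-22 : (0F , 2F) ⊑ᵍ (2F , 2F)
  ⊑-02-22 = (λ ()) , λ _ → λ { (inj₁ (inj₁ ())) ; (inj₁ (inj₂ e)) → inj₁ (inj₁ (cong suc (≡.sym e))) ; (inj₂ q) → inj₂ q }
  ⊑-20-22 : (2F , 0F) ⊑ᵍ (2F , 2F)
  ⊑-20-22 = (λ ()) , λ _ → λ { (inj₁ q) → inj₁ q ; (inj₂ (inj₁ ())) ; (inj₂ (inj₂ e)) → inj₂ (inj₁ (cong suc (≡.sym e))) }
  ⊑-30-32 : (3F , 0F) ⊑ᵍ (3F , 2F)
  ⊑-30-32 = (λ ()) , λ _ → λ { (inj₁ q) → inj₁ q ; (inj₂ (inj₁ ())) ; (inj₂ (inj₂ e)) → inj₂ (inj₁ (cong suc (≡.sym e))) }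

  -- (3 , 3) is adjacent to (3 , 2) but not to (3 , 0).
  ⋢-32-30 : ¬ (3F , 2F) ⊑ᵍ (3F , 0F)
  ⋢-32-30 (_ , N⊆N) with N⊆N (3F , 3F) (inj₂ (inj₂ refl))
  ... | inj₁ (inj₁ ())
  ... | inj₁ (inj₂ ())
  ... | inj₂ (inj₁ ())
  ... | inj₂ (inj₂ ())

  -- Both coordinates of (2 , 2) are interior, so nothing properly dominates it.
  undominated-22 : ∀ y → ¬ (2F , 2F) ⊑ᵍ y
  undominated-22 y 22⊑y = proj₁ 22⊑y (≡.sym (point-injective (cong₂ _,_
    (interior-undominated (λ ()) (λ ()) (proj₁ (grid-domination 2≤s 2≤t 22⊑y)))
    (interior-undominated (λ ()) (λ ()) (proj₂ (grid-domination 2≤s 2≤t 22⊑y))))))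

  -- The common neighbours of the far corner (s - 1 , 0) and of (0 , 1) are
  -- the three points (s - 2 , 0), (s - 2 , 2) and (1 , 1).
  far-neighbour : Fin 3 → Point
  far-neighbour 0F = suc (suc s′) , 0
  far-neighbour 1F = suc (suc s′) , 2
  far-neighbour 2F = 1 , 1

  far-neighbours : ∀ e g → e < s → (Step e (suc (suc (suc s′))) ⊎ Step g 0) → (Step e 0 ⊎ Step g 1) →
    Σ (Fin 3) λ k → (e , g) ≡ far-neighbour k
  far-neighbours _ _ _   (inj₁ (inj₁ refl)) (inj₁ (inj₁ ()))
  far-neighbours _ _ _   (inj₁ (inj₁ refl)) (inj₁ (inj₂ ()))
  far-neighbours _ _ _   (inj₁ (inj₁ refl)) (inj₂ (inj₁ refl)) = 0F , refl
  far-neighbours _ _ _   (inj₁ (inj₁ refl)) (inj₂ (inj₂ refl)) = 1F , refl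
  far-neighbours _ _ e<s (inj₁ (inj₂ refl)) _                  = ⊥-elim (ℕ.<-irrefl refl e<s)
  far-neighbours _ _ _   (inj₂ (inj₁ ()))   _
  far-neighbours _ _ _   (inj₂ (inj₂ refl)) (inj₁ (inj₁ ()))
  far-neighbours _ _ _   (inj₂ (inj₂ refl)) (inj₁ (inj₂ refl)) = 2F , refl
  far-neighbours _ _ _   (inj₂ (inj₂ refl)) (inj₂ y~1)         = ⊥-elim (step-irrefl y~1)

  -- Domination pins
  -- (2 , 1), (0 , 0) and (2 , 2); pinning by adjacency then settles the 4 × 4
  -- corner, row propagation on the first four columns gives columns 0 and 1,
  -- and column induction gives the rest.
  module Rigid (σ : Vertex s t ⤖ Vertex s t) (aut : IsAutomorphism (P s ✱ P t) σ)
               (fixed-01 : Bijection.to σ (0F , 1F) ≡ (0F , 1F)) where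

    open GridAutomorphism σ aut

    dominated-image : ∀ {x y} → Fixed x → x ⊑ᵍ y → x ⊑ᵍ f y
    dominated-image fx≡x x⊑y = subst (_⊑ᵍ f _) fx≡x (⊑-preserved x⊑y)

    -- (0 , 1) ⊑ (2 , 1): the image of (2 , 1) stays in the interior column 1
    -- and, being distinct from (0 , 1), is (2 , 1).
    fixed-21 : Fixed (2F , 1F)
    fixed-21 = point-injective (cong₂ _,_ (row (proj₁ dominations)) column)
      where
        01⊑ = dominated-image fixed-01 ⊑-01-21
        dominations = grid-domination 2≤s 2≤t 01⊑
        column : toℕ (proj₂ (f (2F , 1F))) ≡ 1
        column = interior-undominated (λ ()) (λ ()) (proj₂ dominations)
        row : Domination s 0 (toℕ (proj₁ (f (2F , 1F)))) → toℕ (proj₁ (f (2F , 1F))) ≡ 2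
        row (self r≡0)         = ⊥-elim (proj₁ 01⊑ (≡.sym (point-injective (cong₂ _,_ r≡0 column))))
        row (first-end _ r≡2)  = r≡2
        row (last-end () _)

    -- (0 , 0) has the two dominators (0 , 2) and (2 , 0), so its image is a
    -- corner; adjacency to (0 , 1) places it in column 0.
    image-00-corner : End s (toℕ (proj₁ (f (0F , 0F)))) × toℕ (proj₂ (f (0F , 0F))) ≡ 0
    image-00-corner = proj₁ corner , column (subst (Adj (P s ✱ P t) (f (0F , 0F))) fixed-01 (preserves (inj₂ (inj₁ refl))))
      where
        corner = two-dominators-corner 2≤s 2≤t (⊑-preserved ⊑-00-02) (⊑-preserved ⊑-00-20) (λ e → case f-injective e of λ ())
        column : Adj (P s ✱ P t) (f (0F , 0F)) (0F , 1F) → toℕ (proj₂ (f (0F , 0F))) ≡ 0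
        column (inj₂ (inj₁ c+1≡1)) = ℕ.suc-injective c+1≡1
        column (inj₂ (inj₂ 2≡c)) = Sum.[ (λ c≡0 → case trans 2≡c c≡0 of λ ()) , (λ c+1≡t → case trans (cong suc 2≡c) c+1≡t of λ ()) ]′ (proj₂ corner)
        column (inj₁ (inj₁ ()))
        column (inj₁ (inj₂ 1≡r)) = Sum.[ (λ r≡0 → case trans 1≡r r≡0 of λ ()) , (λ r+1≡s → case trans (cong suc 1≡r) r+1≡s of λ ()) ]′ (proj₁ corner)

    -- Were (0 , 0) sent to the far corner (s - 1 , 0), its four common
    -- neighbours (1 , 0), …, (1 , 3) with the fixed (0 , 1) would be sent
    -- injectively to the three common neighbours of (s - 1 , 0) and (0 , 1).
    not-far-corner : suc (toℕ (proj₁ (f (0F , 0F)))) ≢ s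
    not-far-corner last = ℕ.<-irrefl (trans (≡.sym (toℕ-↑ˡ i t′)) (trans (cong toℕ (≡.sym same)) (toℕ-↑ˡ j t′))) i<j
      where
        image : Fin 4 → Vertex s t
        image i = f (1F , i ↑ˡ t′)
        class : ∀ i → Σ (Fin 3) λ k → point (image i) ≡ far-neighbour k
        class i = far-neighbours _ _ (toℕ<n (proj₁ (image i)))
          (Sum.map (subst (Step _) (ℕ.suc-injective last)) (subst (Step _) (proj₂ image-00-corner)) (preserves (inj₁ (inj₂ refl))))
          (subst (Adj (P s ✱ P t) (image i)) fixed-01 (preserves (inj₁ (inj₂ refl))))
        collision = pigeonhole (s≤s (s≤s (s≤s (s≤s z≤n)))) (proj₁ ∘ class)
        i = proj₁ collision
        j = proj₁ (proj₂ collision)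
        i<j = proj₁ (proj₂ (proj₂ collision))
        same : j ↑ˡ t′ ≡ i ↑ˡ t′
        same = cong proj₂ (f-injective (point-injective (trans (proj₂ (class j))
                 (trans (cong far-neighbour (≡.sym (proj₂ (proj₂ (proj₂ collision))))) (≡.sym (proj₂ (class i)))))))

    fixed-00 : Fixed (0F , 0F)
    fixed-00 = Sum.[ (λ r≡0 → point-injective (cong₂ _,_ r≡0 (proj₂ image-00-corner))) , (⊥-elim ∘ not-far-corner) ]′
                   (proj₁ image-00-corner)

    -- (0 , 0) ⊑ (2 , 2), so the image of (2 , 2) is one of (2 , 2), (0 , 2),
    -- (2 , 0); the latter two dominate (2 , 2), which nothing does.
    fixed-22 : Fixed (2F , 2F)
    fixed-22 = settle (grid-domination 2≤s 2≤t 00⊑)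
      where
        00⊑ = dominated-image fixed-00 ⊑-00-22
        image-undominated : ∀ {v} → f (2F , 2F) ≡ v → ¬ v ⊑ᵍ (2F , 2F)
        image-undominated f22≡v v⊑22 = undominated-22 (proj₁ (preimage (2F , 2F)))
          (⊑-reflected (subst₂ _⊑ᵍ_ (≡.sym f22≡v) (≡.sym (proj₂ (preimage (2F , 2F)))) v⊑22))
        at : ∀ a b → toℕ (proj₁ (f (2F , 2F))) ≡ toℕ a → toℕ (proj₂ (f (2F , 2F))) ≡ toℕ b → f (2F , 2F) ≡ (a , b)
        at _ _ r c = point-injective (cong₂ _,_ r c)
        settle : Domination s 0 (toℕ (proj₁ (f (2F , 2F)))) × Domination t 0 (toℕ (proj₂ (f (2F , 2F)))) → Fixed (2F , 2F)
        settle (first-end _ r≡2 , first-end _ c≡2) = at 2F 2F r≡2 c≡2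
        settle (self r≡0        , self c≡0)        = ⊥-elim (proj₁ 00⊑ (≡.sym (at 0F 0F r≡0 c≡0)))
        settle (self r≡0        , first-end _ c≡2) = ⊥-elim (image-undominated (at 0F 2F r≡0 c≡2) ⊑-02-22)
        settle (first-end _ r≡2 , self c≡0)        = ⊥-elim (image-undominated (at 2F 0F r≡2 c≡0) ⊑-20-22)
        settle (last-end () _ , _)
        settle (_ , last-end () _)

    known : List (Vertex s t)
    known = (0F , 1F) ∷ (2F , 1F) ∷ (0F , 0F) ∷ (2F , 2F) ∷ []

    known-fixed : All Fixed known
    known-fixed = fixed-01 ∷ fixed-21 ∷ fixed-00 ∷ fixed-22 ∷ []

    -- By adjacency to the known fixed vertices, (3 , 0) and (3 , 2) can only
    -- be fixed or exchanged; an exchange would reverse (3 , 0) ⊑ (3 , 2).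
    fixed-30 : Fixed (3F , 0F)
    fixed-30 = settle (candidates (3F , 0F) _) (candidates (3F , 2F) _)
      where
        row-3 = (3F , 0F) ∷ (3F , 2F) ∷ known
        candidates : ∀ x → T (does (pinned? (point x) (points (diagonal known)) (map point row-3) 7 7)) → f x ∈ row-3
        candidates x = image-pinned (covers-by-7 s) (covers-by-7 t) x (diagonal known) row-3 (All.map⁺ known-fixed)
        settle : f (3F , 0F) ∈ row-3 → f (3F , 2F) ∈ row-3 → Fixed (3F , 0F)
        settle (here e)          _                  = e
        settle (there (there k)) _                  = onto-fixed refl (All.lookup known-fixed k)
        settle (there (here e))  (here e′)          = ⊥-elim (⋢-32-30 (subst₂ _⊑ᵍ_ e e′ (⊑-preserved ⊑-30-32)))
        settle (there (here e))  (there (here e′))  = ⊥-elim (collide e e′ λ ())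
        settle (there (here e))  (there (there k))  = ⊥-elim (collide e (onto-fixed refl (All.lookup known-fixed k)) λ ())

    corner : List (Vertex s t)
    corner = (1F , 1F) ∷ (3F , 1F) ∷ (0F , 3F) ∷ (2F , 3F) ∷ (3F , 2F) ∷ (1F , 3F) ∷ (1F , 0F) ∷ (0F , 2F) ∷ (1F , 2F) ∷ []

    corner-fixed : All Fixed corner
    corner-fixed = propagate (covers-by-7 s) (covers-by-7 t) ((3F , 0F) ∷ known) corner (fixed-30 ∷ known-fixed) _

    first-rows : ∀ z → toℕ (proj₁ z) < 2 → toℕ (proj₂ z) ≤ 3 → Fixed z
    first-rows (0F , 0F) _ _ = fixed-00
    first-rows (0F , 1F) _ _ = fixed-01
    first-rows z@(0F , 2F) _ _ = member-property corner corner-fixed z _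
    first-rows z@(0F , 3F) _ _ = member-property corner corner-fixed z _
    first-rows z@(1F , 0F) _ _ = member-property corner corner-fixed z _
    first-rows z@(1F , 1F) _ _ = member-property corner corner-fixed z _
    first-rows z@(1F , 2F) _ _ = member-property corner corner-fixed z _
    first-rows z@(1F , 3F) _ _ = member-property corner corner-fixed z _
    first-rows (Fin.suc (Fin.suc _) , _) (s≤s (s≤s ())) _
    first-rows (_ , Fin.suc (Fin.suc (Fin.suc (Fin.suc _)))) _ (s≤s (s≤s (s≤s ())))

    everything : ∀ z → Fixed z
    everything = column-induction σ aut 2≤s (λ ()) λ z z<2 →
      row-induction (first-four (s≤s (s≤s (s≤s (s≤s z≤n))))) first-rows z (ℕ.≤-trans (ℕ.<⇒≤ z<2) (s≤s (s≤s z≤n)))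

  F-s×t : List (Vertex s t)
  F-s×t = (0F , 1F) ∷ []

  -- The empty set is not fixing: flipping all rows is a non-trivial automorphism.
  fix-s×t : FixNumber (P s ✱ P t) 1
  fix-s×t = (F-s×t , [] ∷ [] , refl , λ σ aut on-F → Rigid.everything σ aut (on-F _ (here refl))) , lower
    where
      lower : ∀ F → Unique F → IsFixingSet (P s ✱ P t) F → 1 ≤ length F
      lower (_ ∷ _) _ _      = s≤s z≤n
      lower []      _ fixing with fixing-meets-flip fixing 2≤t (λ _ → true) (λ _ _ ne → ⊥-elim (ne refl)) 0F refl
      ... | ()

theorem3p4 : (s t : ℕ) → 2 ≤ s → 2 ≤ t →
    (4 ≤ s → 4 ≤ t → FixNumber (P s ✱ P t) 1)
    × (s ≡ 2 → 4 ≤ t → FixNumber (P s ✱ P t) 2)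
    × (s ≡ 2 → t ≡ 2 → FixNumber (P s ✱ P t) 3)
    × (s ≡ 2 → t ≡ 3 → FixNumber (P s ✱ P t) 3)
    × (s ≡ 3 → t ≡ 3 → FixNumber (P s ✱ P t) 5)
    × (s ≡ 3 → 4 ≤ t → FixNumber (P s ✱ P t) (t + 1))
theorem3p4 s t _ _ =
    (λ { (s≤s (s≤s (s≤s (s≤s _)))) (s≤s (s≤s (s≤s (s≤s _)))) → FourOrMore.fix-s×t _ _ })
  , (λ { refl (s≤s (s≤s (s≤s (s≤s _)))) → TwoRows.fix-2×t _ })
  , (λ { refl refl → fix-2×2 })
  , (λ { refl refl → fix-2×3 })
  , (λ { refl refl → fix-3×3 })
  , (λ { refl (s≤s (s≤s (s≤s (s≤s _)))) → ThreeRows.fix-3×t _ })
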